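{- Let $p$ be a prime and let $C(x_1,\ldots,x_r)=a_1x_1^3+a_2x_2^3+\cdots+a_rx_r^3$ with nonzero integers $a_1,\ldots,a_r$ be primitive (no integer $d>1$ divides all $a_i$). Suppose there are indices $i\neq j$ in $\{1,\ldots,r\}$ with $p\nmid a_i$ and $a_j=p^k\ell$ where $p\nmid \ell$ and $3\mid k$. Let $\alpha=1+\nu_p(3)$. If $a_i^{ -1}\ell$ is a cubic residue modulo $p^\alpha$, then $R(C)$ is dense in $\mathbb{Q}_p$.
   Context: $\nu_p$ denotes the $p$-adic valuation. $R(C)=\{C(\overline{x})/C(\overline{y}) : \overline{x},\overline{y}\in\mathbb{Z}^r,\ C(\overline{y})\neq 0\}$, with density in the $p$-adic topology of $\mathbb{Q}_p$. The inverse $a_i^{ -1}$ is taken modulo $p^\alpha$, and an integer $u$ coprime to $p$ is a cubic residue modulo $p^\alpha$ if $u\equiv x^3\pmod{p^\alpha}$ for some integer $x$. -}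

module Defs where

open import Data.Nat using (ℕ; zero; suc)
open import Data.Fin using (Fin) renaming (zero to fzero; suc to fsuc)
open import Data.Integer using (ℤ; +_; _+_; _*_; _-_; _^_)
open import Data.Integer.Divisibility using (_∣_)
open import Data.Product using (Σ; ∃; _×_)
open import Relation.Binary.PropositionalEquality using (_≡_)
open import Relation.Nullary using (¬_)
import Data.Rational as ℚ
open ℚ using (ℚ; ↥_)

sumFin : ∀ {r} → (Fin r → ℤ) → ℤ
sumFin {zero}  f = + 0
sumFin {suc r} f = f fzero + sumFin (λ i → f (fsuc i))

cubicForm : ∀ {r} → (Fin r → ℤ) → (Fin r → ℤ) → ℤ
cubicForm a x = sumFin (λ i → a i * (x i ^ 3))

Primitive : ∀ {r} → (Fin r → ℤ) → Set
Primitive {r} a = (d : ℕ) → 1 Data.Nat.< d → ¬ ((i : Fin r) → (+ d) ∣ a i)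

toℚ : ℤ → ℚ
toℚ n = n ℚ./ 1

-- membership in R(C) = { C(x)/C(y) : C(y) ≠ 0 }
InR : ∀ {r} → (Fin r → ℤ) → ℚ → Set
InR {r} a q = Σ (Fin r → ℤ) λ x → Σ (Fin r → ℤ) λ y →
  ¬ (cubicForm a y ≡ + 0) × (q ℚ.* toℚ (cubicForm a y) ≡ toℚ (cubicForm a x))

-- ν_p(q) ≥ N for N ≥ 0: p^N divides the numerator of q in lowest terms
-- (q = 0 counts, as ν_p(0) = ∞)
ValGE : ℕ → ℕ → ℚ → Set
ValGE p N q = (+ (p Data.Nat.^ N)) ∣ (↥ q)

-- S ⊆ ℚ is dense in ℚ_p: since ℚ is dense in ℚ_p, equivalent to: every
-- rational q is approximated p-adically arbitrarily well by elements of S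
DenseInQp : ℕ → (ℚ → Set) → Set
DenseInQp p S = (q : ℚ) (N : ℕ) → Σ ℚ λ s → S s × ValGE p N (s ℚ.- q)

CubicResidue : ℕ → ℤ → Set
CubicResidue m u = Σ ℤ λ x → (+ m) ∣ (u - x ^ 3)

-- Put A = aᵢ, k = 3m, M = p^m, α = 1 + ν_p(3) and q = num/den.  For Y = A w eᵢ with
-- w = den·M·p^α and X = M x eᵢ + eⱼ one has C(Y) = A⁴w³ > 0 and
--   C(X)·den − num·C(Y) = den·M³·(A x³ − u),   u = num·A⁴·den²·p^(3α) − ℓ ≡ −ℓ (mod p^α),
-- so C(X)/C(Y) is p-adically as close to q as we like once A x³ ≡ u modulo a high power of p.
-- Modulo p^α, x = −c solves this, where aᵢ⁻¹ℓ ≡ c³.  Hensel's lemma lifts it to every power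
-- of p: the derivative 3A x² has valuation exactly ν_p(3) = α − 1 ≤ 1.
module Submission where

open import Defs
open import Data.Fin using (Fin; zero; suc)
open import Data.Integer using (ℤ; +_; -[1+_]; +[1+_]; _+_; _*_; -_; _-_; ∣_∣)
import Data.Integer as ℤ
open import Data.Integer.Divisibility using (_∣_)
open import Data.Integer.Divisibility.Signed
  using (divides; ∣ᵤ⇒∣; ∣⇒∣ᵤ; ∣-refl; ∣-trans; ∣m∣n⇒∣m+n; ∣m∣n⇒∣m-n; ∣m+n∣m⇒∣n; ∣m⇒∣-m; ∣m⇒∣m*n; ∣n⇒∣m*n; *-monoˡ-∣)
  renaming (_∣_ to _∣ˢ_)
import Data.Integer.Properties as ℤₚ
open import Data.Integer.Solver using (module +-*-Solver)
open import Data.Integer.Tactic.RingSolver using (solve-∀)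
open import Data.Nat as ℕ using (ℕ; zero; suc; _^_; _≤_; z≤n; s≤s; NonZero)
import Data.Nat.Divisibility as ℕD
import Data.Nat.Properties as ℕₚ
open import Algebra.Properties.CommutativeSemigroup ℕₚ.*-commutativeSemigroup using (xy∙z≈y∙xz)
open import Data.Nat.Coprimality using (Coprime; coprime-Bézout)
open import Data.Nat.GCD using (module Bézout)
open import Data.Nat.Primality using (Prime; euclidsLemma; prime⇒irreducible; prime⇒nonZero; prime⇒nonTrivial)
import Data.Rational as ℚ
open ℚ using (ℚ; ↥_; ↧_; ↧ₙ_)
import Data.Rational.Properties as ℚₚ
import Data.Rational.Unnormalised as ℚᵘ
import Data.Rational.Unnormalised.Properties as ℚᵘₚ
open import Data.Product using (Σ; _×_; _,_; proj₁; proj₂; map₂)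
open import Data.Sum using (_⊎_; inj₁; inj₂)
open import Function using (_∘_)
open import Relation.Binary.PropositionalEquality
  using (_≡_; _≢_; refl; sym; trans; cong; cong₂; subst; subst₂; module ≡-Reasoning)
open import Relation.Nullary using (¬_; contradiction; yes; no)

m^n∣m^o : ∀ m {n o} → n ≤ o → m ^ n ℕD.∣ m ^ o
m^n∣m^o m {n} {o} n≤o = subst (λ k → m ^ n ℕD.∣ m ^ k) (ℕₚ.m+[n∸m]≡n n≤o)
  (subst (m ^ n ℕD.∣_) (sym (ℕₚ.^-distribˡ-+-* m n (o ℕ.∸ n))) (ℕD.m∣m*n (m ^ (o ℕ.∸ n))))

i^m∣i^n : ∀ i {m n} → m ≤ n → i ℤ.^ m ∣ˢ i ℤ.^ n
i^m∣i^n i {m} {n} m≤n = subst (λ k → i ℤ.^ m ∣ˢ i ℤ.^ k) (ℕₚ.m+[n∸m]≡n m≤n)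
  (subst (i ℤ.^ m ∣ˢ_) (sym (ℤₚ.^-distribˡ-+-* i m (n ℕ.∸ m))) (∣m⇒∣m*n (i ℤ.^ (n ℕ.∸ m)) ∣-refl))

pos-^ : ∀ m n → + (m ^ n) ≡ (+ m) ℤ.^ n
pos-^ m zero    = refl
pos-^ m (suc n) = trans (ℤₚ.pos-* m (m ^ n)) (cong (+ m *_) (pos-^ m n))

pos-bézout : ∀ a b c d → 1 ℕ.+ a ℕ.* b ≡ c ℕ.* d → + 1 + + a * + b ≡ + c * + d
pos-bézout a b c d eq =
  trans (cong (λ z → + 1 + z) (sym (ℤₚ.pos-* a b))) (trans (cong +_ eq) (ℤₚ.pos-* c d))

1+a≡b⇒b-1≡a : ∀ {a b} → + 1 + a ≡ b → b - + 1 ≡ a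
1+a≡b⇒b-1≡a {a} refl = cancel a
  where
  cancel : ∀ a → + 1 + a - + 1 ≡ a
  cancel = solve-∀

module _ {p : ℕ} (p-prime : Prime p) where

  private instance
    p≢0 : NonZero p
    p≢0 = prime⇒nonZero p-prime

  prime∤⇒coprime : ∀ {n} → ¬ p ℕD.∣ n → Coprime p n
  prime∤⇒coprime p∤n (d∣p , d∣n) with prime⇒irreducible p-prime d∣p
  ... | inj₁ d≡1  = d≡1
  ... | inj₂ refl = contradiction d∣n p∤n

  p^e∣m*n⇒p^e∣m : ∀ e {m n} → ¬ p ℕD.∣ n → p ^ e ℕD.∣ m ℕ.* n → p ^ e ℕD.∣ m
  p^e∣m*n⇒p^e∣m zero    p∤n _ = ℕD.1∣ _
  p^e∣m*n⇒p^e∣m (suc e) {m} {n} p∤n p^[1+e]∣mn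
    with euclidsLemma m n p-prime (ℕD.∣-trans (ℕD.m∣m*n (p ^ e)) p^[1+e]∣mn)
  ... | inj₂ p∣n = contradiction p∣n p∤n
  ... | inj₁ (ℕD.divides m′ refl) =
    subst (ℕD._∣ m′ ℕ.* p) (ℕₚ.*-comm (p ^ e) p) (ℕD.*-monoˡ-∣ p (p^e∣m*n⇒p^e∣m e {m′} p∤n p^e∣m′n))
    where
    p^e∣m′n : p ^ e ℕD.∣ m′ ℕ.* n
    p^e∣m′n = ℕD.*-cancelˡ-∣ p (subst (p ℕ.* p ^ e ℕD.∣_) (xy∙z≈y∙xz m′ p n) p^[1+e]∣mn)

  -- ν_p(1 + n) ≤ n, so the factor 1 + n absorbs at most n of the powers of p.
  p^[e+1+n]∣m*[1+n]⇒p^e∣m : ∀ e n {m} → p ^ (e ℕ.+ suc n) ℕD.∣ m ℕ.* suc n → p ^ e ℕD.∣ m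
  p^[e+1+n]∣m*[1+n]⇒p^e∣m e n = bounded (suc n) ℕₚ.≤-refl
    where
    bounded : ∀ b {n m} → suc n ≤ b → p ^ (e ℕ.+ b) ℕD.∣ m ℕ.* suc n → p ^ e ℕD.∣ m
    bounded (suc b) {n} {m} (s≤s n≤b) p^[e+b]∣m[1+n] with p ℕD.∣? suc n
    ... | no p∤1+n =
      ℕD.∣-trans (m^n∣m^o p (ℕₚ.m≤m+n e (suc b))) (p^e∣m*n⇒p^e∣m (e ℕ.+ suc b) p∤1+n p^[e+b]∣m[1+n])
    ... | yes (ℕD.divides (suc n′) 1+n≡[1+n′]p) =
      bounded b (ℕₚ.≤-trans (ℕₚ.≤-pred n′<n) n≤b) (ℕD.*-cancelʳ-∣ p (subst₂ ℕD._∣_ split regroup p^[e+b]∣m[1+n]))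
      where
      n′<n : suc n′ ℕ.< suc n
      n′<n = subst (suc n′ ℕ.<_) (sym 1+n≡[1+n′]p)
        (ℕₚ.m<m*n (suc n′) p (ℕ.nonTrivial⇒n>1 p {{prime⇒nonTrivial p-prime}}))
      split : p ^ (e ℕ.+ suc b) ≡ p ^ (e ℕ.+ b) ℕ.* p
      split = trans (cong (p ^_) (ℕₚ.+-suc e b)) (ℕₚ.*-comm p (p ^ (e ℕ.+ b)))
      regroup : m ℕ.* suc n ≡ m ℕ.* suc n′ ℕ.* p
      regroup = trans (cong (m ℕ.*_) 1+n≡[1+n′]p) (sym (ℕₚ.*-assoc m (suc n′) p))

  p^v∣3⇒v≤1 : ∀ {v} → p ^ v ℕD.∣ 3 → v ≤ 1
  p^v∣3⇒v≤1 {zero}        _ = z≤n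
  p^v∣3⇒v≤1 {suc zero}    _ = s≤s z≤n
  p^v∣3⇒v≤1 {suc (suc v)} p^v∣3 =
    contradiction (ℕD.∣⇒≤ (ℕD.∣-trans (m^n∣m^o p {2} {suc (suc v)} (s≤s (s≤s z≤n))) p^v∣3)) (ℕₚ.<⇒≱ 3<p²)
    where
    2≤p : 2 ≤ p
    2≤p = ℕ.nonTrivial⇒n>1 p {{prime⇒nonTrivial p-prime}}
    3<p² : 3 ℕ.< p ^ 2
    3<p² = ℕₚ.*-mono-≤ 2≤p (subst (2 ≤_) (sym (ℕₚ.*-identityʳ p)) 2≤p)

  P^n-positive : ∀ n → (+ p) ℤ.^ n ≡ + suc (ℕ.pred (p ^ n))
  P^n-positive n = trans (sym (pos-^ p n)) (cong +_ (sym (ℕₚ.suc-pred (p ^ n) {{ℕₚ.m^n≢0 p n}})))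

  prime∤-* : ∀ {a b} → ¬ + p ∣ˢ a → ¬ + p ∣ˢ b → ¬ + p ∣ˢ a * b
  prime∤-* {a} {b} p∤a p∤b p∣ab
    with euclidsLemma ∣ a ∣ ∣ b ∣ p-prime (subst (p ℕD.∣_) (ℤₚ.abs-* a b) (∣⇒∣ᵤ p∣ab))
  ... | inj₁ p∣a = p∤a (∣ᵤ⇒∣ p∣a)
  ... | inj₂ p∣b = p∤b (∣ᵤ⇒∣ p∣b)

  inverse-mod-prime : ∀ w → ¬ + p ∣ˢ w → Σ ℤ λ b → + p ∣ˢ w * b - + 1
  inverse-mod-prime (+ n) p∤n with coprime-Bézout (prime∤⇒coprime (p∤n ∘ ∣ᵤ⇒∣))
  ... | Bézout.-+ x y 1+xp≡yn =
    + y , divides (+ x) (1+a≡b⇒b-1≡a (trans (pos-bézout x p y n 1+xp≡yn) (ℤₚ.*-comm (+ y) (+ n))))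
  ... | Bézout.+- x y 1+yn≡xp =
    - + y , divides (- + x)
      (trans (negate (+ n) (+ y)) (trans (cong -_ (pos-bézout y n x p 1+yn≡xp)) (ℤₚ.neg-distribˡ-* (+ x) (+ p))))
    where
    negate : ∀ n y → n * - y - + 1 ≡ - (+ 1 + y * n)
    negate = solve-∀
  inverse-mod-prime -[1+ n ] p∤w with inverse-mod-prime +[1+ n ] (p∤w ∘ ∣m⇒∣-m)
  ... | b , p∣nb-1 = - b , subst (λ z → + p ∣ˢ z - + 1) (sym (-a*-b≡a*b +[1+ n ] b)) p∣nb-1
    where
    -a*-b≡a*b : ∀ a b → - a * - b ≡ a * b
    -a*-b≡a*b = solve-∀

root-from-residue : ∀ {m} A inv ℓ c u → m ∣ˢ A * inv - + 1 → m ∣ˢ inv * ℓ - c ℤ.^ 3 → m ∣ˢ u + ℓ →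
  m ∣ˢ A * (- c) ℤ.^ 3 - u
root-from-residue {m} A inv ℓ c u m∣Ainv-1 m∣invℓ-c³ m∣u+ℓ =
  subst (m ∣ˢ_) (combination A inv ℓ c u)
    (∣m∣n⇒∣m-n (∣m∣n⇒∣m-n (∣n⇒∣m*n A m∣invℓ-c³) (∣n⇒∣m*n ℓ m∣Ainv-1)) m∣u+ℓ)
  where
  open +-*-Solver
  combination : ∀ A inv ℓ c u →
    A * (inv * ℓ - c ℤ.^ 3) - ℓ * (A * inv - + 1) - (u + ℓ) ≡ A * (- c) ℤ.^ 3 - u
  combination = solve 5 (λ A inv ℓ c u →
    A :* (inv :* ℓ :- c :^ 3) :- ℓ :* (A :* inv :- con (+ 1)) :- (u :+ ℓ) := A :* (:- c) :^ 3 :- u) refl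

-- Modulo P m, moving x by d s changes A x³ − u by 3 A x² d s = e A x² s · m, which cancels the
-- error t m when e A x² s ≡ −t (mod P).
cube-lift-step : ∀ P m d e A u x t b →
  A * x ℤ.^ 3 - u ≡ t * m → + 3 * d ≡ e * m → P ∣ˢ d → P * m ∣ˢ d * (d * d) →
  P ∣ˢ e * (A * x * x) * b - + 1 →
  P * m ∣ˢ A * (x + d * (- t * b)) ℤ.^ 3 - u
cube-lift-step P m d e A u x t b error≡tm 3d≡em P∣d Pm∣d³ P∣wb-1 =
  subst (P * m ∣ˢ_) (sym expansion)
    (∣m∣n⇒∣m+n (∣m∣n⇒∣m+n (*-monoˡ-∣ m P∣t+ws) (*-monoˡ-∣ m (∣m⇒∣m*n _ P∣d))) (∣m⇒∣m*n _ Pm∣d³))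
  where
  open ≡-Reasoning
  open +-*-Solver
  s : ℤ
  s = - t * b

  taylor : ∀ A x d s u → A * (x + d * s) ℤ.^ 3 - u ≡
    (A * x ℤ.^ 3 - u) + + 3 * d * (A * x * x * s) + + 3 * d * (d * A * x * s * s) + d * (d * d) * (A * s * s * s)
  taylor = solve 5 (λ A x d s u → A :* (x :+ d :* s) :^ 3 :- u :=
    (A :* x :^ 3 :- u) :+ con (+ 3) :* d :* (A :* x :* x :* s) :+ con (+ 3) :* d :* (d :* A :* x :* s :* s)
      :+ d :* (d :* d) :* (A :* s :* s :* s)) refl

  regroup : ∀ t m e A x s d c → t * m + e * m * (A * x * x * s) + e * m * (d * A * x * s * s) + c ≡
    (t + e * (A * x * x) * s) * m + d * (e * A * x * s * s) * m + c
  regroup = solve-∀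

  expansion : A * (x + d * s) ℤ.^ 3 - u ≡
    (t + e * (A * x * x) * s) * m + d * (e * A * x * s * s) * m + d * (d * d) * (A * s * s * s)
  expansion = begin
    A * (x + d * s) ℤ.^ 3 - u
      ≡⟨ taylor A x d s u ⟩
    (A * x ℤ.^ 3 - u) + + 3 * d * (A * x * x * s) + + 3 * d * (d * A * x * s * s) + d * (d * d) * (A * s * s * s)
      ≡⟨ cong₂ (λ E T → E + T * (A * x * x * s) + T * (d * A * x * s * s) + d * (d * d) * (A * s * s * s))
           error≡tm 3d≡em ⟩
    t * m + e * m * (A * x * x * s) + e * m * (d * A * x * s * s) + d * (d * d) * (A * s * s * s)
      ≡⟨ regroup t m e A x s d (d * (d * d) * (A * s * s * s)) ⟩
    (t + e * (A * x * x) * s) * m + d * (e * A * x * s * s) * m + d * (d * d) * (A * s * s * s) ∎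

  P∣t+ws : P ∣ˢ t + e * (A * x * x) * s
  P∣t+ws = subst (P ∣ˢ_) (factor t (e * (A * x * x)) b) (∣n⇒∣m*n (- t) P∣wb-1)
    where
    factor : ∀ t w b → - t * (w * b - + 1) ≡ t + w * (- t * b)
    factor = solve-∀

module CubeRootLifting {p : ℕ} (p-prime : Prime p) (v : ℕ) (p^v∣3 : p ^ v ℕD.∣ 3) (p^1+v∤3 : ¬ p ^ suc v ℕD.∣ 3)
                       (A u : ℤ) (p∤A : ¬ + p ∣ˢ A) (p∤u : ¬ + p ∣ˢ u) where

  P : ℤ
  P = + p

  IsRootMod : ℕ → ℤ → Set
  IsRootMod n x = P ℤ.^ n ∣ˢ A * x ℤ.^ 3 - u

  private
    e : ℕ
    e = ℕD.quotient p^v∣3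

    3≡e*P^v : + 3 ≡ + e * P ℤ.^ v
    3≡e*P^v = trans (cong +_ (ℕD._∣_.equality p^v∣3)) (trans (ℤₚ.pos-* e (p ^ v)) (cong (+ e *_) (pos-^ p v)))

    p∤e : ¬ P ∣ˢ + e
    p∤e p∣e = p^1+v∤3 (subst (p ^ suc v ℕD.∣_) (sym (ℕD._∣_.equality p^v∣3)) (ℕD.*-monoˡ-∣ (p ^ v) (∣⇒∣ᵤ p∣e)))

  p∤root : ∀ n x → IsRootMod (suc n) x → ¬ P ∣ˢ x
  p∤root n x root p∣x = p∤u (subst (P ∣ˢ_) (a-[a-u]≡u (A * x ℤ.^ 3) u)
    (∣m∣n⇒∣m-n (∣n⇒∣m*n A (∣m⇒∣m*n (x ℤ.^ 2) p∣x)) (∣-trans (∣m⇒∣m*n (P ℤ.^ n) ∣-refl) root)))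
    where
    a-[a-u]≡u : ∀ a u → a - (a - u) ≡ u
    a-[a-u]≡u = solve-∀

  lift-step : ∀ K x → IsRootMod (K ℕ.+ suc v) x → Σ ℤ (IsRootMod (suc K ℕ.+ suc v))
  lift-step K x root@(divides t error≡tm) with inverse-mod-prime p-prime (+ e * (A * x * x)) p∤w
    where
    p∤x : ¬ P ∣ˢ x
    p∤x = p∤root (K ℕ.+ v) x (subst (λ n → IsRootMod n x) (ℕₚ.+-suc K v) root)
    p∤w : ¬ P ∣ˢ + e * (A * x * x)
    p∤w = prime∤-* p-prime p∤e (prime∤-* p-prime (prime∤-* p-prime p∤A p∤x) p∤x)
  ... | b , P∣wb-1 = x + d * (- t * b) ,
    cube-lift-step P _ d (+ e) A u x t b error≡tm 3d≡em (∣m⇒∣m*n (P ℤ.^ K) ∣-refl) Pm∣d³ P∣wb-1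
    where
    open ≡-Reasoning
    d : ℤ
    d = P ℤ.^ suc K

    3d≡em : + 3 * d ≡ + e * P ℤ.^ (K ℕ.+ suc v)
    3d≡em = begin
      + 3 * d                   ≡⟨ cong (_* d) 3≡e*P^v ⟩
      + e * P ℤ.^ v * d         ≡⟨ ℤₚ.*-assoc (+ e) (P ℤ.^ v) d ⟩
      + e * (P ℤ.^ v * d)       ≡⟨ cong (+ e *_) (ℤₚ.^-distribˡ-+-* P v (suc K)) ⟨
      + e * P ℤ.^ (v ℕ.+ suc K) ≡⟨ cong (λ n → + e * P ℤ.^ n) (trans (ℕₚ.+-comm v (suc K)) (sym (ℕₚ.+-suc K v))) ⟩
      + e * P ℤ.^ (K ℕ.+ suc v) ∎

    Pm∣d³ : P ℤ.^ (suc K ℕ.+ suc v) ∣ˢ d * (d * d)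
    Pm∣d³ = subst (P ℤ.^ (suc K ℕ.+ suc v) ∣ˢ_) P^[3+3K]≡d³
      (i^m∣i^n P (ℕₚ.+-monoʳ-≤ (suc K)
        (ℕₚ.≤-trans (s≤s (p^v∣3⇒v≤1 p-prime p^v∣3)) (ℕₚ.+-mono-≤ (s≤s z≤n) (s≤s z≤n)))))
      where
      P^[3+3K]≡d³ : P ℤ.^ (suc K ℕ.+ (suc K ℕ.+ suc K)) ≡ d * (d * d)
      P^[3+3K]≡d³ =
        trans (ℤₚ.^-distribˡ-+-* P (suc K) _) (cong (d *_) (ℤₚ.^-distribˡ-+-* P (suc K) (suc K)))

  lift : ∀ x₀ → IsRootMod (suc v) x₀ → ∀ K → Σ ℤ (IsRootMod (K ℕ.+ suc v))
  lift x₀ root zero    = x₀ , root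
  lift x₀ root (suc K) = let x , rootₖ = lift x₀ root K in lift-step K x rootₖ

  root-mod-every-power : ∀ x₀ → IsRootMod (suc v) x₀ → ∀ n → Σ ℤ (IsRootMod n)
  root-mod-every-power x₀ root n = map₂ (∣-trans (i^m∣i^n P (ℕₚ.m≤m+n n (suc v)))) (lift x₀ root n)

single : ∀ {r} → Fin r → ℤ → Fin r → ℤ
single zero    c zero    = c
single zero    c (suc _) = + 0
single (suc i) c zero    = + 0
single (suc i) c (suc k) = single i c k

single-disjoint : ∀ {r} {i j : Fin r} → i ≢ j → ∀ c c′ k → single i c k ≡ + 0 ⊎ single j c′ k ≡ + 0
single-disjoint {i = zero}  {zero}  i≢j c c′ k       = contradiction refl i≢j
single-disjoint {i = zero}  {suc j} i≢j c c′ zero    = inj₂ refl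
single-disjoint {i = zero}  {suc j} i≢j c c′ (suc k) = inj₁ refl
single-disjoint {i = suc i} {zero}  i≢j c c′ zero    = inj₁ refl
single-disjoint {i = suc i} {zero}  i≢j c c′ (suc k) = inj₂ refl
single-disjoint {i = suc i} {suc j} i≢j c c′ zero    = inj₁ refl
single-disjoint {i = suc i} {suc j} i≢j c c′ (suc k) = single-disjoint (i≢j ∘ cong suc) c c′ k

sumFin-cong : ∀ {r} {f g : Fin r → ℤ} → (∀ k → f k ≡ g k) → sumFin f ≡ sumFin g
sumFin-cong {zero}  f≗g = refl
sumFin-cong {suc r} f≗g = cong₂ _+_ (f≗g zero) (sumFin-cong (f≗g ∘ suc))

sumFin-+ : ∀ {r} (f g : Fin r → ℤ) → sumFin (λ k → f k + g k) ≡ sumFin f + sumFin g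
sumFin-+ {zero}  f g = refl
sumFin-+ {suc r} f g = trans (cong (_+_ (f zero + g zero)) (sumFin-+ (f ∘ suc) (g ∘ suc)))
  (interchange (f zero) (g zero) (sumFin (f ∘ suc)) (sumFin (g ∘ suc)))
  where
  interchange : ∀ a b c d → a + b + (c + d) ≡ a + c + (b + d)
  interchange = solve-∀

cubicForm-zero : ∀ {r} (a : Fin r → ℤ) → cubicForm a (λ _ → + 0) ≡ + 0
cubicForm-zero {zero}  a = refl
cubicForm-zero {suc r} a = cong₂ _+_ (ℤₚ.*-zeroʳ (a zero)) (cubicForm-zero (a ∘ suc))

cubicForm-single : ∀ {r} (a : Fin r → ℤ) i c → cubicForm a (single i c) ≡ a i * c ℤ.^ 3
cubicForm-single {suc r} a zero c =
  trans (cong (_+_ (a zero * c ℤ.^ 3)) (cubicForm-zero (a ∘ suc))) (ℤₚ.+-identityʳ _)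
cubicForm-single {suc r} a (suc i) c =
  trans (cong₂ _+_ (ℤₚ.*-zeroʳ (a zero)) (cubicForm-single (a ∘ suc) i c)) (ℤₚ.+-identityˡ _)

cubicForm-+ : ∀ {r} (a x y : Fin r → ℤ) → (∀ k → x k ≡ + 0 ⊎ y k ≡ + 0) →
  cubicForm a (λ k → x k + y k) ≡ cubicForm a x + cubicForm a y
cubicForm-+ a x y disjoint =
  trans (sumFin-cong termwise) (sumFin-+ (λ k → a k * x k ℤ.^ 3) (λ k → a k * y k ℤ.^ 3))
  where
  open +-*-Solver
  termwise : ∀ k → a k * (x k + y k) ℤ.^ 3 ≡ a k * x k ℤ.^ 3 + a k * y k ℤ.^ 3
  termwise k with disjoint k
  ... | inj₁ xₖ≡0 rewrite xₖ≡0 =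
    solve 2 (λ a y → a :* (con (+ 0) :+ y) :^ 3 := a :* con (+ 0) :^ 3 :+ a :* y :^ 3) refl (a k) (y k)
  ... | inj₂ yₖ≡0 rewrite yₖ≡0 =
    solve 2 (λ a x → a :* (x :+ con (+ 0)) :^ 3 := a :* x :^ 3 :+ a :* con (+ 0) :^ 3) refl (a k) (x k)

cubicForm-single+single : ∀ {r} (a : Fin r → ℤ) {i j} → i ≢ j → ∀ c c′ →
  cubicForm a (λ k → single i c k + single j c′ k) ≡ a i * c ℤ.^ 3 + a j * c′ ℤ.^ 3
cubicForm-single+single a {i} {j} i≢j c c′ =
  trans (cubicForm-+ a (single i c) (single j c′) (single-disjoint i≢j c c′))
        (cong₂ _+_ (cubicForm-single a i c) (cubicForm-single a j c′))

square-positive : ∀ z → z ≢ + 0 → Σ ℕ λ n → z * z ≡ + suc n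
square-positive (+ zero)  z≢0 = contradiction refl z≢0
square-positive +[1+ n ] _   = _ , refl
square-positive -[1+ n ] _   = _ , refl

A*[A*w]³-positive : ∀ {A w w′} → A ≢ + 0 → w ≡ + suc w′ → Σ ℕ λ D → A * (A * w) ℤ.^ 3 ≡ + suc D
A*[A*w]³-positive {A} {w} A≢0 refl =
  let s , A²≡1+s = square-positive A A≢0 in
  _ , trans (regroup A w) (cong (λ A² → A² * A² * (w * w * w)) A²≡1+s)
  where
  open +-*-Solver
  regroup : ∀ A w → A * (A * w) ℤ.^ 3 ≡ A * A * (A * A) * (w * w * w)
  regroup = solve 2 (λ A w → A :* (A :* w) :^ 3 := A :* A :* (A :* A) :* (w :* w :* w)) refl

/-*-cancel : ∀ i d → i ℚ./ suc d ℚ.* toℚ (+ suc d) ≡ toℚ i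
/-*-cancel i d = ℚₚ.toℚᵘ-injective (begin
  ℚ.toℚᵘ (i ℚ./ suc d ℚ.* toℚ (+ suc d))
    ≈⟨ ℚₚ.toℚᵘ-homo-* (i ℚ./ suc d) (toℚ (+ suc d)) ⟩
  ℚ.toℚᵘ (i ℚ./ suc d) ℚᵘ.* ℚ.toℚᵘ (toℚ (+ suc d))
    ≈⟨ ℚᵘₚ.*-cong (ℚₚ.toℚᵘ-fromℚᵘ (ℚᵘ.mkℚᵘ i d)) (ℚₚ.toℚᵘ-fromℚᵘ (ℚᵘ.mkℚᵘ (+ suc d) 0)) ⟩
  ℚᵘ.mkℚᵘ i d ℚᵘ.* ℚᵘ.mkℚᵘ (+ suc d) 0
    ≈⟨ ℚᵘ.*≡* (trans (ℤₚ.*-identityʳ _) (cong (λ n → i * + n) (sym (ℕₚ.*-identityʳ (suc d))))) ⟩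
  ℚᵘ.mkℚᵘ i 0
    ≈⟨ ℚₚ.toℚᵘ-fromℚᵘ (ℚᵘ.mkℚᵘ i 0) ⟨
  ℚ.toℚᵘ (toℚ i) ∎)
  where open ℚᵘₚ.≃-Reasoning

↥[i/n-q]-cross : ∀ i d q →
  ↥ (i ℚ./ suc d ℚ.- q) * + (suc d ℕ.* ↧ₙ q) ≡ (i * ↧ q - ↥ q * + suc d) * ↧ (i ℚ./ suc d ℚ.- q)
↥[i/n-q]-cross i d q@(ℚ.mkℚ _ _ _) = trans (drop-*≡* x x≃i/n-q)
  (cong (λ z → (i * ↧ q + z) * ↧ x) (sym (ℤₚ.neg-distribˡ-* (↥ q) (+ suc d))))
  where
  drop-*≡* : ∀ x {y} → ℚ.toℚᵘ x ℚᵘ.≃ y → ↥ x * ℚᵘ.↧ y ≡ ℚᵘ.↥ y * ↧ x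
  drop-*≡* (ℚ.mkℚ _ _ _) = ℚᵘₚ.drop-*≡*
  x : ℚ
  x = i ℚ./ suc d ℚ.- q
  x≃i/n-q : ℚ.toℚᵘ x ℚᵘ.≃ ℚᵘ.mkℚᵘ i d ℚᵘ.- ℚ.toℚᵘ q
  x≃i/n-q = ℚᵘₚ.≃-trans (ℚₚ.toℚᵘ-homo-+ (i ℚ./ suc d) (ℚ.- q))
    (ℚᵘₚ.+-cong (ℚₚ.toℚᵘ-fromℚᵘ (ℚᵘ.mkℚᵘ i d)) (ℚₚ.toℚᵘ-homo‿- q))

valGE-of-cross : ∀ {p} → Prime p → ∀ N x num n →
  ↥ x * + suc n ≡ num * ↧ x → p ^ (N ℕ.+ suc n) ℕD.∣ ∣ num ∣ → ValGE p N x
valGE-of-cross {p} p-prime N x num n cross p^∣num =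
  p^[e+1+n]∣m*[1+n]⇒p^e∣m p-prime N n
    (subst (p ^ (N ℕ.+ suc n) ℕD.∣_) abs-cross (ℕD.∣-trans p^∣num (ℕD.m∣m*n (↧ₙ x))))
  where
  abs-cross : ∣ num ∣ ℕ.* ↧ₙ x ≡ ∣ ↥ x ∣ ℕ.* suc n
  abs-cross = trans (sym (ℤₚ.abs-* num (↧ x))) (trans (cong ∣_∣ (sym cross)) (ℤₚ.abs-* (↥ x) (+ suc n)))

-- C(X)/C(Y) with C(Y) = 1 + D approximates q: the extra (1 + D)·den q powers of p
-- absorb the p-part of the denominator C(Y)·den q of C(X)/C(Y) − q.
Approximant : ∀ {r} → ℕ → (Fin r → ℤ) → ℚ → ℕ → Set
Approximant {r} p a q N = Σ (Fin r → ℤ) λ X → Σ (Fin r → ℤ) λ Y → Σ ℕ λ D →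
  cubicForm a Y ≡ + suc D × p ^ (N ℕ.+ suc D ℕ.* ↧ₙ q) ℕD.∣ ∣ cubicForm a X * ↧ q - ↥ q * + suc D ∣

denseInQp-of-approximants : ∀ {p r} → Prime p → (a : Fin r → ℤ) → (∀ q N → Approximant p a q N) →
  DenseInQp p (InR a)
denseInQp-of-approximants p-prime a approximant q N with approximant q N
... | X , Y , D , CY≡1+D , p^∣numerator =
  s , (X , Y , CY≢0 , s*CY≡CX) ,
  valGE-of-cross p-prime N (s ℚ.- q) (cubicForm a X * ↧ q - ↥ q * + suc D) _
    (↥[i/n-q]-cross (cubicForm a X) D q) p^∣numerator
  where
  s : ℚ
  s = cubicForm a X ℚ./ suc D
  CY≢0 : cubicForm a Y ≢ + 0
  CY≢0 CY≡0 with trans (sym CY≡1+D) CY≡0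
  ... | ()
  s*CY≡CX : s ℚ.* toℚ (cubicForm a Y) ≡ toℚ (cubicForm a X)
  s*CY≡CX rewrite CY≡1+D = /-*-cancel (cubicForm a X) D

approximant-numerator : ∀ A M x ℓ d n Pα →
  (A * (M * x) ℤ.^ 3 + M ℤ.^ 3 * ℓ * + 1) * d - n * (A * (A * (d * (M * Pα))) ℤ.^ 3) ≡
  (d * M ℤ.^ 3) * (A * x ℤ.^ 3 - (n * (A * A * A * A) * (d * d) * (Pα * Pα) * Pα - ℓ))
approximant-numerator = solve 7 (λ A M x ℓ d n Pα →
  (A :* (M :* x) :^ 3 :+ M :^ 3 :* ℓ :* con (+ 1)) :* d :- n :* (A :* (A :* (d :* (M :* Pα))) :^ 3) :=
  (d :* M :^ 3) :* (A :* x :^ 3 :- (n :* (A :* A :* A :* A) :* (d :* d) :* (Pα :* Pα) :* Pα :- ℓ))) refl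
  where open +-*-Solver

denseInQp-of-cubeRoots : ∀ {p r} → Prime p → (a : Fin r → ℤ) {i j : Fin r} → a i ≢ + 0 → i ≢ j →
  ∀ {k ℓ} → a j ≡ + (p ^ k) * ℓ → 3 ℕD.∣ k → ∀ α →
  (∀ u → (+ p) ℤ.^ α ∣ˢ u + ℓ → ∀ n → Σ ℤ λ x → (+ p) ℤ.^ n ∣ˢ a i * x ℤ.^ 3 - u) →
  DenseInQp p (InR a)
denseInQp-of-cubeRoots {p} p-prime a {i} {j} aᵢ≢0 i≢j {k} {ℓ} aⱼ≡pᵏℓ (ℕD.divides m k≡m*3) α cubeRoot =
  denseInQp-of-approximants p-prime a approximant
  where
  P M : ℤ
  P = + p
  M = P ℤ.^ m

  aⱼ≡M³ℓ : a j ≡ M ℤ.^ 3 * ℓ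
  aⱼ≡M³ℓ = trans aⱼ≡pᵏℓ (cong (_* ℓ) pᵏ≡M³)
    where
    pᵏ≡M³ : + (p ^ k) ≡ M ℤ.^ 3
    pᵏ≡M³ = trans (pos-^ p k) (trans (cong (P ℤ.^_) k≡m*3) (sym (ℤₚ.^-*-assoc P m 3)))

  approximant : ∀ q N → Approximant p a q N
  approximant q N = X , Y , D , CY≡1+D , p^n∣numerator
    where
    open ≡-Reasoning
    A w W u : ℤ
    A = a i
    w = ↧ q * (M * P ℤ.^ α)
    W = ↥ q * (A * A * A * A) * (↧ q * ↧ q) * (P ℤ.^ α * P ℤ.^ α)
    u = W * P ℤ.^ α - ℓ

    positive : Σ ℕ λ D → A * (A * w) ℤ.^ 3 ≡ + suc D
    positive = A*[A*w]³-positive aᵢ≢0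
      (cong₂ (λ M Pα → ↧ q * (M * Pα)) (P^n-positive p-prime m) (P^n-positive p-prime α))
    D n : ℕ
    D = proj₁ positive
    n = N ℕ.+ suc D ℕ.* ↧ₙ q

    root : Σ ℤ λ x → P ℤ.^ n ∣ˢ A * x ℤ.^ 3 - u
    root = cubeRoot u (divides W (cancel W (P ℤ.^ α) ℓ)) n
      where
      cancel : ∀ W Pα ℓ → W * Pα - ℓ + ℓ ≡ W * Pα
      cancel = solve-∀
    x : ℤ
    x = proj₁ root

    Y X : Fin _ → ℤ
    Y = single i (A * w)
    X = λ k → single i (M * x) k + single j (+ 1) k
    CY≡1+D : cubicForm a Y ≡ + suc D
    CY≡1+D = trans (cubicForm-single a i (A * w)) (proj₂ positive)
    CX≡ : cubicForm a X ≡ A * (M * x) ℤ.^ 3 + M ℤ.^ 3 * ℓ * + 1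
    CX≡ = trans (cubicForm-single+single a i≢j (M * x) (+ 1)) (cong (λ aⱼ → A * (M * x) ℤ.^ 3 + aⱼ * + 1) aⱼ≡M³ℓ)

    numerator : cubicForm a X * ↧ q - ↥ q * + suc D ≡ (↧ q * M ℤ.^ 3) * (A * x ℤ.^ 3 - u)
    numerator = begin
      cubicForm a X * ↧ q - ↥ q * + suc D
        ≡⟨ cong₂ (λ CX CY → CX * ↧ q - ↥ q * CY) CX≡ (sym (proj₂ positive)) ⟩
      (A * (M * x) ℤ.^ 3 + M ℤ.^ 3 * ℓ * + 1) * ↧ q - ↥ q * (A * (A * w) ℤ.^ 3)
        ≡⟨ approximant-numerator A M x ℓ (↧ q) (↥ q) (P ℤ.^ α) ⟩
      (↧ q * M ℤ.^ 3) * (A * x ℤ.^ 3 - u) ∎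

    p^n∣numerator : p ^ n ℕD.∣ ∣ cubicForm a X * ↧ q - ↥ q * + suc D ∣
    p^n∣numerator = subst (ℕD._∣ ∣ cubicForm a X * ↧ q - ↥ q * + suc D ∣) (cong ∣_∣ (sym (pos-^ p n)))
      (∣⇒∣ᵤ (subst (P ℤ.^ n ∣ˢ_) (sym numerator) (∣n⇒∣m*n (↧ q * M ℤ.^ 3) (proj₂ root))))

corollary1p3 : (p : ℕ) → Prime p → (r : ℕ) → (a : Fin r → ℤ) →
    ((i : Fin r) → a i ≢ + 0) → Primitive a →
    (i j : Fin r) → i ≢ j → ¬ ((+ p) ∣ a i) →
    (k : ℕ) → (ℓ : ℤ) → a j ≡ (+ (p ^ k)) * ℓ → ¬ ((+ p) ∣ ℓ) → 3 ℕD.∣ k →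
    (v : ℕ) → (p ^ v) ℕD.∣ 3 → ¬ ((p ^ suc v) ℕD.∣ 3) →
    (Σ ℤ λ inv → ((+ (p ^ suc v)) ∣ (a i * inv - + 1)) × CubicResidue (p ^ suc v) (inv * ℓ)) →
    DenseInQp p (InR a)
corollary1p3 p p-prime r a a≢0 _ i j i≢j p∤aᵢ k ℓ aⱼ≡pᵏℓ p∤ℓ 3∣k v p^v∣3 p^1+v∤3 (inv , aᵢinv≡1 , c , invℓ≡c³) =
  denseInQp-of-cubeRoots p-prime a (a≢0 i) i≢j aⱼ≡pᵏℓ 3∣k (suc v) cubeRoot
  where
  signed : ∀ n z → + (p ^ n) ∣ z → (+ p) ℤ.^ n ∣ˢ z
  signed n z = subst (_∣ˢ z) (pos-^ p n) ∘ ∣ᵤ⇒∣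

  cubeRoot : ∀ u → (+ p) ℤ.^ suc v ∣ˢ u + ℓ → ∀ n → Σ ℤ λ x → (+ p) ℤ.^ n ∣ˢ a i * x ℤ.^ 3 - u
  cubeRoot u p^α∣u+ℓ =
    CubeRootLifting.root-mod-every-power p-prime v p^v∣3 p^1+v∤3 (a i) u (p∤aᵢ ∘ ∣⇒∣ᵤ) p∤u (- c)
      (root-from-residue (a i) inv ℓ c u
        (signed (suc v) (a i * inv - + 1) aᵢinv≡1) (signed (suc v) (inv * ℓ - c ℤ.^ 3) invℓ≡c³) p^α∣u+ℓ)
    where
    p∤u : ¬ + p ∣ˢ u
    p∤u p∣u = p∤ℓ (∣⇒∣ᵤ (∣m+n∣m⇒∣n (∣-trans (∣m⇒∣m*n ((+ p) ℤ.^ v) ∣-refl) p^α∣u+ℓ) p∣u))
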